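{- Let $m\ge3$ and consider the instance $I$ on $m$ machines with $m+1$ jobs $J_1,\dots,J_{m+1}$ arriving in this order, each with $u_j=2$ and $t_j=1$, whose processing times are chosen adaptively by an adversary against a deterministic online algorithm $A$ as follows: exactly two jobs get $p_j=0$ and the other $m-1$ get $p_j=2$; when $J_j$ is handled, let $z$ be the number of earlier jobs already given $p=0$; if $J_j$ is untested and $z<2$ then $p_j=0$; if $J_j$ is tested, then $p_j=0$ if $z<2$ and $m+2-j\le 2-z$, and $p_j=2$ otherwise; if $J_j$ is untested and $z=2$ then $p_j=2$. (Equivalently, the first two untested jobs, if they exist, get $p_j=0$, and any remaining zeros go to the last jobs of the sequence.) Then for every deterministic online algorithm $A$, either $C^A(I)\ge4$, or $C^A(I)=3$ and $C^A_{\min}(I)\ge2$, where $C^A(I)$ and $C^A_{\min}(I)$ are the maximum and minimum machine load in the schedule produced by $A$.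
   Context: Online scheduling with testing on $m$ identical machines: jobs arrive one by one; on arrival of $J_j$ its $u_j,t_j$ are revealed and the algorithm irrevocably decides whether to test $J_j$ and which machine processes it. An untested job adds $u_j$ to its machine's load; a tested job adds $t_j+p_j$, and $p_j$ is revealed to the algorithm after testing. The load of a machine is the total time of the jobs assigned to it. -}

module Defs where

open import Data.Nat using (ℕ; zero; suc; _+_; _∸_; _≤_; _⊔_; _⊓_; _<?_; _≤?_; _≟_)
open import Data.Bool using (Bool; true; false; if_then_else_; _∧_)
open import Data.Fin using (Fin)
import Data.Fin as F
open import Data.Maybe using (Maybe; just; nothing)
open import Data.List using (List; []; _∷_; _++_; [_]; map; filter; foldr)
open import Data.Nat.ListAction using (sum)
open import Data.List using () renaming (allFin to allFinL)
open import Data.Product using (_×_; _,_; proj₁; proj₂)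
open import Relation.Nullary.Decidable using (⌊_⌋)

record Job (m : ℕ) : Set where
  constructor job
  field
    u t p   : ℕ
    tested  : Bool
    machine : Fin m

-- What the online algorithm sees about a past job: u, t, its own decisions,
-- and p only if the job was tested.
record Obs (m : ℕ) : Set where
  constructor obs
  field
    u t      : ℕ
    tested   : Bool
    machine  : Fin m
    revealed : Maybe ℕ

view : ∀ {m} → Job m → Obs m
view (job u t p b i) = obs u t b i (if b then just p else nothing)

-- A deterministic online algorithm: given the observations of the previous jobs
-- (in arrival order) and (u_j , t_j) of the current job, decide whether to
-- test it and on which machine to put it.
Alg : ℕ → Set
Alg m = List (Obs m) → ℕ → ℕ → Bool × Fin m

time : ∀ {m} → Job m → ℕ
time (job u t p true  i) = t + p
time (job u t p false i) = u

-- Adversary of the instance I: p_j for job j (1-based), given z = number of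
-- earlier jobs with p = 0 and whether J_j is tested.
advP : (m j z : ℕ) → Bool → ℕ
advP m j z false = if ⌊ z <? 2 ⌋ then 0 else 2
advP m j z true  = if ⌊ z <? 2 ⌋ ∧ ⌊ (m + 2 ∸ j) ≤? (2 ∸ z) ⌋ then 0 else 2

-- Run A on the instance: j = index of next job, k = number of jobs remaining,
-- z = zeros given so far, h = jobs scheduled so far (arrival order).
run : (m : ℕ) → Alg m → (j k z : ℕ) → List (Job m) → List (Job m)
run m A j zero    z h = h
run m A j (suc k) z h =
  let d = A (map view h) 2 1
      b = proj₁ d
      i = proj₂ d
      p = advP m j z b
      z′ = if ⌊ p ≟ 0 ⌋ then suc z else z
  in run m A (suc j) k z′ (h ++ [ job 2 1 p b i ])

schedule : (m : ℕ) → Alg m → List (Job m)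
schedule m A = run m A 1 (suc m) 0 []

load : ∀ {m} → List (Job m) → Fin m → ℕ
load {m} s i = sum (map time (filter (λ jb → i F.≟ Job.machine jb) s))

loads : ∀ {m} → List (Job m) → List ℕ
loads {m} s = map (load s) (allFinL m)

maxL : List ℕ → ℕ
maxL = foldr _⊔_ 0

minL : List ℕ → ℕ
minL []       = 0
minL (x ∷ xs) = foldr _⊓_ x xs

Cmax : (m : ℕ) → Alg m → ℕ
Cmax m A = maxL (loads (schedule m A))

Cmin : (m : ℕ) → Alg m → ℕ
Cmin m A = minL (loads (schedule m A))

{-# OPTIONS --safe #-}
-- Call a job heavy if it takes at least 2 time units; two heavy jobs on one
-- machine give it load at least 4. The adversary answers untested jobs with
-- p = 0 while it has zeros left and tested ones with p = 2, so until a light job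
-- (tested, p = 0) occurs, all jobs are heavy and the total time is at least 3 per
-- job minus the zeros handed out. It only creates a light job when the jobs still
-- to come can absorb all remaining zeros, which keeps the total time at least
-- 3m − 1. Hence either all m + 1 jobs are heavy and some machine has load ≥ 4, or
-- the m loads, each at most 3, sum to at least 3m − 1, so all are ≥ 2 and one is 3.
module Submission where

open import Defs
open import Data.Nat
open import Data.Nat.Properties
open import Data.Nat.Tactic.RingSolver using (solve-∀)
open import Data.Nat.ListAction using (sum)
open import Data.Nat.ListAction.Properties using (sum-++)
open import Data.Bool using (Bool; true; false; if_then_else_)
open import Data.Fin using (Fin)
import Data.Fin as F
open import Data.List using (List; []; _∷_; _++_; [_]; map; length; filter; tabulate) renaming (allFin to allFinL)
open import Data.List.Properties using (map-++; map-cong; length-++; length-map; length-tabulate; map-tabulate; foldr-forcesᵇ; foldr-preservesᵇ)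
open import Data.List.Relation.Unary.All as All using (All; []; _∷_)
open import Data.List.Relation.Unary.All.Properties using (map⁺; map⁻)
open import Data.Product using (_×_; _,_; proj₁; proj₂)
open import Data.Sum using (_⊎_; inj₁; inj₂; map₂) renaming (map to ⊎-map)
open import Function using (_∘_)
open import Relation.Nullary using (yes; no; does; contradiction)
open import Relation.Nullary.Decidable using (⌊_⌋)
open import Relation.Binary.PropositionalEquality hiding ([_])
open import Algebra.Properties.CommutativeSemigroup +-commutativeSemigroup using () renaming (interchange to +-interchange; xy∙z≈xz∙y to +-right-comm; x∙yz≈y∙xz to +-left-comm)

sum-map-∷ʳ : ∀ {A : Set} (f : A → ℕ) xs x → sum (map f (xs ++ [ x ])) ≡ sum (map f xs) + f x
sum-map-∷ʳ f xs x = begin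
  sum (map f (xs ++ [ x ]))   ≡⟨ cong sum (map-++ f xs [ x ]) ⟩
  sum (map f xs ++ [ f x ])   ≡⟨ sum-++ (map f xs) [ f x ] ⟩
  sum (map f xs) + (f x + 0)  ≡⟨ cong (sum (map f xs) +_) (+-identityʳ (f x)) ⟩
  sum (map f xs) + f x        ∎
  where open ≡-Reasoning

length-∷ʳ : ∀ {A : Set} (xs : List A) x → length (xs ++ [ x ]) ≡ suc (length xs)
length-∷ʳ xs x = trans (length-++ xs) (+-comm (length xs) 1)

sum-map-+ : ∀ {A : Set} (f g : A → ℕ) xs → sum (map (λ a → f a + g a) xs) ≡ sum (map f xs) + sum (map g xs)
sum-map-+ f g []       = refl
sum-map-+ f g (x ∷ xs) = begin
  (f x + g x) + sum (map (λ a → f a + g a) xs)     ≡⟨ cong (f x + g x +_) (sum-map-+ f g xs) ⟩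
  (f x + g x) + (sum (map f xs) + sum (map g xs))  ≡⟨ +-interchange (f x) (g x) (sum (map f xs)) (sum (map g xs)) ⟩
  (f x + sum (map f xs)) + (g x + sum (map g xs))  ∎
  where open ≡-Reasoning

sum≤*length : ∀ {c} {xs : List ℕ} → All (_≤ c) xs → sum xs ≤ c * length xs
sum≤*length             []           = z≤n
sum≤*length {c} {_ ∷ xs} (x≤c ∷ xs≤c) =
  ≤-trans (+-mono-≤ x≤c (sum≤*length xs≤c)) (≤-reflexive (sym (*-suc c (length xs))))

maxL≤⇒All≤ : ∀ {c} xs → maxL xs ≤ c → All (_≤ c) xs
maxL≤⇒All≤ = foldr-forcesᵇ (λ x y x⊔y≤c → m⊔n≤o⇒m≤o x y x⊔y≤c , m⊔n≤o⇒n≤o x y x⊔y≤c) 0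

≤-minL : ∀ {c x xs} → All (c ≤_) (x ∷ xs) → c ≤ minL (x ∷ xs)
≤-minL (c≤x ∷ c≤xs) = foldr-preservesᵇ ⊓-glb c≤x c≤xs

All≤-deficit : ∀ {c d xs} → All (_≤ c) xs → c * length xs ≤ sum xs + d → All (λ x → c ≤ x + d) xs
All≤-deficit                 []           _    = []
All≤-deficit {c} {d} {x ∷ xs} (x≤c ∷ xs≤c) full = c≤x+d ∷ All≤-deficit xs≤c tail-full
  where
    open ≤-Reasoning
    n S : ℕ
    n = length xs
    S = sum xs
    full′ : c + c * n ≤ x + S + d
    full′ = subst (_≤ x + S + d) (*-suc c n) full
    c≤x+d : c ≤ x + d
    c≤x+d = +-cancelʳ-≤ (c * n) c (x + d) (begin
      c + c * n      ≤⟨ full′ ⟩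
      x + S + d      ≤⟨ +-monoˡ-≤ d (+-monoʳ-≤ x (sum≤*length xs≤c)) ⟩
      x + c * n + d  ≡⟨ +-right-comm x (c * n) d ⟩
      x + d + c * n  ∎)
    tail-full : c * n ≤ S + d
    tail-full = +-cancelˡ-≤ c (c * n) (S + d) (begin
      c + c * n      ≤⟨ full′ ⟩
      x + S + d      ≤⟨ +-monoˡ-≤ d (+-monoˡ-≤ S x≤c) ⟩
      c + S + d      ≡⟨ +-assoc c S d ⟩
      c + (S + d)    ∎)

maxL-reaches : ∀ {c d} xs → c * length xs ≤ sum xs + d → d < length xs → c ≤ maxL xs
maxL-reaches {c} {d} xs full d<n with c ≤? maxL xs
... | yes c≤M = c≤M
... | no  c≰M = contradiction d<n (≤⇒≯ n≤d)
  where
    open ≤-Reasoning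
    M n : ℕ
    M = maxL xs
    n = length xs
    n≤d : n ≤ d
    n≤d = +-cancelʳ-≤ (M * n) n d (begin
      n + M * n  ≤⟨ *-monoˡ-≤ n (≰⇒> c≰M) ⟩
      c * n      ≤⟨ full ⟩
      sum xs + d ≤⟨ +-monoˡ-≤ d (sum≤*length (maxL≤⇒All≤ xs ≤-refl)) ⟩
      M * n + d  ≡⟨ +-comm (M * n) d ⟩
      d + M * n  ∎)

loads-nearly-full : ∀ xs → maxL xs ≤ 3 → 3 * length xs ≤ sum xs + 1 → 2 ≤ length xs →
                    (maxL xs ≡ 3) × (2 ≤ minL xs)
loads-nearly-full (x ∷ xs) max≤3 full 2≤n =
  ≤-antisym max≤3 (maxL-reaches (x ∷ xs) full 2≤n) ,
  ≤-minL (All.map (+-cancelʳ-≤ 1 2 _) (All≤-deficit (maxL≤⇒All≤ (x ∷ xs) max≤3) full))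

onMachine : ∀ {m} → Fin m → List (Job m) → List (Job m)
onMachine i = filter (λ jb → i F.≟ Job.machine jb)

machineTotal : ∀ {m} → (Job m → ℕ) → List (Job m) → Fin m → ℕ
machineTotal f s i = sum (map f (onMachine i s))

sum-map-zero : ∀ {A : Set} (xs : List A) → sum (map (λ _ → 0) xs) ≡ 0
sum-map-zero []       = refl
sum-map-zero (_ ∷ xs) = sum-map-zero xs

indicator : ∀ {n} → Fin n → ℕ → Fin n → ℕ
indicator k a i = if does (i F.≟ k) then a else 0

sum-tabulate-indicator : ∀ {n} (k : Fin n) a → sum (tabulate (indicator k a)) ≡ a
sum-tabulate-indicator {suc n} F.zero    a = begin
  a + sum (tabulate {n = n} (λ _ → 0))  ≡⟨ cong (λ xs → a + sum xs) (map-tabulate (λ (i : Fin n) → i) (λ _ → 0)) ⟨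
  a + sum (map (λ _ → 0) (allFinL n))   ≡⟨ cong (a +_) (sum-map-zero (allFinL n)) ⟩
  a + 0                                 ≡⟨ +-identityʳ a ⟩
  a                                     ∎
  where open ≡-Reasoning
sum-tabulate-indicator {suc n} (F.suc k) a = sum-tabulate-indicator k a

sum-indicator : ∀ {n} (k : Fin n) a → sum (map (indicator k a) (allFinL n)) ≡ a
sum-indicator k a = trans (cong sum (map-tabulate (λ i → i) (indicator k a))) (sum-tabulate-indicator k a)

machineTotal-∷ : ∀ {m} (f : Job m → ℕ) x s i →
                 machineTotal f (x ∷ s) i ≡ indicator (Job.machine x) (f x) i + machineTotal f s i
machineTotal-∷ f x s i with i F.≟ Job.machine x
... | yes _ = refl
... | no  _ = refl

sum-machineTotal : ∀ {m} (f : Job m → ℕ) s → sum (map (machineTotal f s) (allFinL m)) ≡ sum (map f s)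
sum-machineTotal {m} f []      = sum-map-zero (allFinL m)
sum-machineTotal {m} f (x ∷ s) = begin
  sum (map (machineTotal f (x ∷ s)) (allFinL m))
    ≡⟨ cong sum (map-cong (machineTotal-∷ f x s) (allFinL m)) ⟩
  sum (map (λ i → indicator (Job.machine x) (f x) i + machineTotal f s i) (allFinL m))
    ≡⟨ sum-map-+ (indicator (Job.machine x) (f x)) (machineTotal f s) (allFinL m) ⟩
  sum (map (indicator (Job.machine x) (f x)) (allFinL m)) + sum (map (machineTotal f s) (allFinL m))
    ≡⟨ cong₂ _+_ (sum-indicator (Job.machine x) (f x)) (sum-machineTotal f s) ⟩
  f x + sum (map f s) ∎
  where open ≡-Reasoning

length-allFin : ∀ n → length (allFinL n) ≡ n
length-allFin n = length-tabulate (λ i → i)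

totalTime : ∀ {m} → List (Job m) → ℕ
totalTime s = sum (map time s)

sum-loads : ∀ {m} (s : List (Job m)) → sum (loads s) ≡ totalTime s
sum-loads = sum-machineTotal time

length-loads : ∀ {m} (s : List (Job m)) → length (loads s) ≡ m
length-loads {m} s = trans (length-map (load s) (allFinL m)) (length-allFin m)

heavy : ℕ → ℕ
heavy 0             = 0
heavy 1             = 0
heavy (suc (suc _)) = 1

heavy+heavy≤ : ∀ n → heavy n + heavy n ≤ n
heavy+heavy≤ 0             = z≤n
heavy+heavy≤ 1             = z≤n
heavy+heavy≤ (suc (suc n)) = s≤s (s≤s z≤n)

heavies : ∀ {m} → List (Job m) → ℕ
heavies s = sum (map (heavy ∘ time) s)

heavies+heavies≤totalTime : ∀ {m} (s : List (Job m)) → heavies s + heavies s ≤ totalTime s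
heavies+heavies≤totalTime []       = z≤n
heavies+heavies≤totalTime (x ∷ s) =
  ≤-trans (≤-reflexive (+-interchange (heavy (time x)) (heavies s) (heavy (time x)) (heavies s)))
          (+-mono-≤ (heavy+heavy≤ (time x)) (heavies+heavies≤totalTime s))

n+n≤3⇒n≤1 : ∀ n → n + n ≤ 3 → n ≤ 1
n+n≤3⇒n≤1 0             _               = z≤n
n+n≤3⇒n≤1 1             _               = s≤s z≤n
n+n≤3⇒n≤1 (suc (suc n)) (s≤s (s≤s le)) = contradiction (m+n≤o⇒n≤o n le) λ { (s≤s ()) }

heavies≤machines : ∀ {m} (s : List (Job m)) → maxL (loads s) ≤ 3 → heavies s ≤ m
heavies≤machines {m} s max≤3 = begin
  heavies s                                                 ≡⟨ sum-machineTotal (heavy ∘ time) s ⟨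
  sum (map (machineTotal (heavy ∘ time) s) (allFinL m))       ≤⟨ sum≤*length (map⁺ one-heavy-per-machine) ⟩
  1 * length (map (machineTotal (heavy ∘ time) s) (allFinL m)) ≡⟨ *-identityˡ _ ⟩
  length (map (machineTotal (heavy ∘ time) s) (allFinL m))     ≡⟨ length-map _ (allFinL m) ⟩
  length (allFinL m)                                        ≡⟨ length-allFin m ⟩
  m                                                         ∎
  where
    open ≤-Reasoning
    one-heavy-per-machine : All (λ i → heavies (onMachine i s) ≤ 1) (allFinL m)
    one-heavy-per-machine = All.map
      (λ {i} load≤3 → n+n≤3⇒n≤1 _ (≤-trans (heavies+heavies≤totalTime (onMachine i s)) load≤3))
      (map⁻ (maxL≤⇒All≤ (loads s) max≤3))

-- r counts the jobs still to come, the current one included, and z the zeros given so far.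
data Response (r z : ℕ) : Bool → ℕ → Set where
  untested-zero : Response r z false 0
  untested-two  : 2 ≤ z → Response r z false 2
  tested-zero   : r + z ≤ 2 → Response r z true 0
  tested-two    : Response r z true 2

advP-response : ∀ m j z b → Response (m + 2 ∸ j) z b (advP m j z b)
advP-response m j z false with z <? 2
... | yes _   = untested-zero
... | no  z≮2 = untested-two (≮⇒≥ z≮2)
advP-response m j z true with z <? 2 | (m + 2 ∸ j) ≤? (2 ∸ z)
... | yes z<2 | yes r≤2∸z = tested-zero (m≤o∸n⇒m+n≤o _ (<⇒≤ z<2) r≤2∸z)
... | yes _   | no  _     = tested-two
... | no  _   | _         = tested-two

-- Here r counts the jobs after h and z the zeros given so far.
data Invariant {m} (r z : ℕ) (h : List (Job m)) : Set where
  all-heavy   : heavies h ≡ length h → 2 ≤ z ⊎ 3 * length h ≤ totalTime h + z → Invariant r z h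
  enough-time : 3 * length h + 2 * r ≤ totalTime h + 4 → Invariant r z h

all-heavy-∷ʳ : ∀ {m r z} (h : List (Job m)) x → heavies h ≡ length h → heavy (time x) ≡ 1 →
               2 ≤ z ⊎ 3 * suc (length h) ≤ (totalTime h + time x) + z → Invariant r z (h ++ [ x ])
all-heavy-∷ʳ {z = z} h x heavies≡ heavy-x zeros = all-heavy (begin
  heavies (h ++ [ x ])           ≡⟨ sum-map-∷ʳ (heavy ∘ time) h x ⟩
  heavies h + heavy (time x)     ≡⟨ cong₂ _+_ heavies≡ heavy-x ⟩
  length h + 1                   ≡⟨ +-comm (length h) 1 ⟩
  suc (length h)                 ≡⟨ length-∷ʳ h x ⟨
  length (h ++ [ x ])            ∎)
  (subst₂ (λ L T → 2 ≤ z ⊎ 3 * L ≤ T + z) (sym (length-∷ʳ h x)) (sym (sum-map-∷ʳ time h x)) zeros)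
  where open ≡-Reasoning

enough-time-∷ʳ : ∀ {m r z} (h : List (Job m)) x →
                 3 * suc (length h) + 2 * r ≤ (totalTime h + time x) + 4 → Invariant r z (h ++ [ x ])
enough-time-∷ʳ {r = r} h x bound =
  enough-time (subst₂ (λ L T → 3 * L + 2 * r ≤ T + 4) (sym (length-∷ʳ h x)) (sym (sum-map-∷ʳ time h x)) bound)

heavy-step : ∀ L τ z′ {T z} → 3 * L ≤ T + z → 3 + z ≤ τ + z′ → 3 * suc L ≤ (T + τ) + z′
heavy-step L τ z′ {T} {z} bound gain = begin
  3 * suc L        ≡⟨ *-suc 3 L ⟩
  3 + 3 * L        ≤⟨ +-monoʳ-≤ 3 bound ⟩
  3 + (T + z)      ≡⟨ +-left-comm 3 T z ⟩
  T + (3 + z)      ≤⟨ +-monoʳ-≤ T gain ⟩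
  T + (τ + z′)     ≡⟨ +-assoc T τ z′ ⟨
  (T + τ) + z′     ∎
  where open ≤-Reasoning

z+2r≤2 : ∀ {r z} → suc r + z ≤ 2 → z + 2 * r ≤ 2
z+2r≤2 {zero}        {z}     (s≤s z≤1)     = ≤-trans (≤-reflexive (+-identityʳ z)) (m≤n⇒m≤1+n z≤1)
z+2r≤2 {suc zero}    {zero}  _             = ≤-refl
z+2r≤2 {suc zero}    {suc z} (s≤s (s≤s ()))
z+2r≤2 {suc (suc r)}         (s≤s (s≤s ()))

light-step : ∀ L r {T z} → 3 * L ≤ T + z → suc r + z ≤ 2 → 3 * suc L + 2 * r ≤ (T + 1) + 4
light-step L r {T} {z} bound r+z<2 = begin
  3 * suc L + 2 * r      ≤⟨ +-monoˡ-≤ (2 * r) (heavy-step L 3 z bound ≤-refl) ⟩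
  (T + 3) + z + 2 * r    ≡⟨ +-assoc (T + 3) z (2 * r) ⟩
  (T + 3) + (z + 2 * r)  ≤⟨ +-monoʳ-≤ (T + 3) (z+2r≤2 {r} {z} r+z<2) ⟩
  (T + 3) + 2            ≡⟨ trans (+-assoc T 3 2) (sym (+-assoc T 1 4)) ⟩
  (T + 1) + 4            ∎
  where open ≤-Reasoning

3[1+L]+2r≡3L+2[1+r]+1 : ∀ L r → 3 * suc L + 2 * r ≡ 3 * L + 2 * suc r + 1
3[1+L]+2r≡3L+2[1+r]+1 = solve-∀

late-step : ∀ L r {T τ} → 3 * L + 2 * suc r ≤ T + 4 → 1 ≤ τ → 3 * suc L + 2 * r ≤ (T + τ) + 4
late-step L r {T} {τ} bound 1≤τ = begin
  3 * suc L + 2 * r        ≡⟨ 3[1+L]+2r≡3L+2[1+r]+1 L r ⟩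
  3 * L + 2 * suc r + 1    ≤⟨ +-mono-≤ bound 1≤τ ⟩
  T + 4 + τ                ≡⟨ +-right-comm T 4 τ ⟩
  T + τ + 4                ∎
  where open ≤-Reasoning

1≤time-job : ∀ {m} p b (i : Fin m) → 1 ≤ time (job 2 1 p b i)
1≤time-job p true  i = s≤s z≤n
1≤time-job p false i = s≤s z≤n

invariant-step : ∀ {m r z b p} (h : List (Job m)) (i : Fin m) → Response (suc r) z b p → Invariant (suc r) z h →
                 Invariant r (if ⌊ p ≟ 0 ⌋ then suc z else z) (h ++ [ job 2 1 p b i ])
invariant-step {r = r} {b = b} {p} h i _ (enough-time bound) =
  enough-time-∷ʳ h _ (late-step (length h) r bound (1≤time-job p b i))
invariant-step {z = z} h i untested-zero (all-heavy heavies≡ zeros) =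
  all-heavy-∷ʳ h _ heavies≡ refl (⊎-map m≤n⇒m≤1+n (λ bound → heavy-step (length h) 2 (suc z) bound ≤-refl) zeros)
invariant-step h i (untested-two 2≤z) (all-heavy heavies≡ _) = all-heavy-∷ʳ h _ heavies≡ refl (inj₁ 2≤z)
invariant-step {z = z} h i tested-two (all-heavy heavies≡ zeros) =
  all-heavy-∷ʳ h _ heavies≡ refl (map₂ (λ bound → heavy-step (length h) 3 z bound ≤-refl) zeros)
invariant-step {r = r} {z} h i (tested-zero r+z≤2) (all-heavy _ (inj₁ 2≤z)) =
  contradiction 2≤z (<⇒≱ (≤-trans (s≤s (m≤n+m z r)) r+z≤2))
invariant-step {r = r} h i (tested-zero r+z≤2) (all-heavy _ (inj₂ bound)) =
  enough-time-∷ʳ h _ (light-step (length h) r bound r+z≤2)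

Outcome : ∀ {m} → List (Job m) → Set
Outcome h = heavies h ≡ length h ⊎ 3 * length h ≤ totalTime h + 4

remaining-suc : ∀ n j {k} → n ∸ j ≡ suc k → n ∸ suc j ≡ k
remaining-suc n j remaining = trans (sym (pred[m∸n]≡m∸[1+n] n j)) (cong pred remaining)

run-outcome : ∀ m (A : Alg m) j k z h → m + 2 ∸ j ≡ k → Invariant k z h → Outcome (run m A j k z h)
run-outcome m A j zero    z h _ (all-heavy heavies≡ _) = inj₁ heavies≡
run-outcome m A j zero    z h _ (enough-time bound)    = inj₂ (subst (_≤ totalTime h + 4) (+-identityʳ (3 * length h)) bound)
run-outcome m A j (suc k) z h remaining inv =
  run-outcome m A (suc j) k _ _ (remaining-suc (m + 2) j remaining)
    (invariant-step h i (subst (λ r → Response r z b (advP m j z b)) remaining (advP-response m j z b)) inv)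
  where
    b : Bool
    b = proj₁ (A (map view h) 2 1)
    i : Fin m
    i = proj₂ (A (map view h) 2 1)

length-run : ∀ m (A : Alg m) j k z h → length (run m A j k z h) ≡ length h + k
length-run m A j zero    z h = sym (+-identityʳ (length h))
length-run m A j (suc k) z h = begin
  length (run m A (suc j) k _ (h ++ [ _ ]))  ≡⟨ length-run m A (suc j) k _ (h ++ [ _ ]) ⟩
  length (h ++ [ _ ]) + k                     ≡⟨ cong (_+ k) (length-∷ʳ h _) ⟩
  suc (length h) + k                          ≡⟨ +-suc (length h) k ⟨
  length h + suc k                            ∎
  where open ≡-Reasoning

schedule-outcome : ∀ m (A : Alg m) → heavies (schedule m A) ≡ suc m ⊎ 3 * m ≤ totalTime (schedule m A) + 1
schedule-outcome m A =
  ⊎-map (λ heavies≡ → trans heavies≡ length≡) tighten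
    (run-outcome m A 1 (suc m) 0 [] remaining₀ (all-heavy refl (inj₂ z≤n)))
  where
    s : List (Job m)
    s = schedule m A
    remaining₀ : m + 2 ∸ 1 ≡ suc m
    remaining₀ = trans (+-∸-assoc m (s≤s z≤n)) (+-comm m 1)
    length≡ : length s ≡ suc m
    length≡ = length-run m A 1 (suc m) 0 []
    tighten : 3 * length s ≤ totalTime s + 4 → 3 * m ≤ totalTime s + 1
    tighten bound = +-cancelˡ-≤ 3 (3 * m) (totalTime s + 1)
      (subst₂ _≤_ (trans (cong (3 *_) length≡) (*-suc 3 m)) (+-left-comm (totalTime s) 3 1) bound)

lemma9 : (m : ℕ) → 3 ≤ m → (A : Alg m) →
         (4 ≤ Cmax m A) ⊎ ((Cmax m A ≡ 3) × (2 ≤ Cmin m A))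
lemma9 m 3≤m A with 4 ≤? Cmax m A
... | yes 4≤Cmax = inj₁ 4≤Cmax
... | no  4≰Cmax = inj₂ (balanced (schedule-outcome m A))
  where
    s : List (Job m)
    s = schedule m A
    Cmax≤3 : Cmax m A ≤ 3
    Cmax≤3 = ≤-pred (≰⇒> 4≰Cmax)
    balanced : heavies s ≡ suc m ⊎ 3 * m ≤ totalTime s + 1 → (Cmax m A ≡ 3) × (2 ≤ Cmin m A)
    balanced (inj₁ heavies≡) = contradiction (subst (_≤ m) heavies≡ (heavies≤machines s Cmax≤3)) 1+n≰n
    balanced (inj₂ time≥) = loads-nearly-full (loads s) Cmax≤3
      (subst₂ (λ n T → 3 * n ≤ T + 1) (sym (length-loads s)) (sym (sum-loads s)) time≥)
      (subst (2 ≤_) (sym (length-loads s)) (≤-trans (s≤s (s≤s z≤n)) 3≤m))
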